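{- The Glasses graph, consisting of two vertex-disjoint triangles together with a single link (a bridge) joining a vertex of one triangle to a vertex of the other (6 vertices, 7 links), is not separable.
   Context: A graph $G=(V,E)$ is separable if there exist non-negative real weights $w(e)$, $e\in E$, and a threshold $\alpha\in\mathbb{R}$ such that for every $E'\subseteq E$: $\sum_{e\in E'}w(e)\ge\alpha$ if and only if the spanning subgraph $(V,E')$ is connected. -}

module Defs where

open import Level using (Level; _⊔_)
open import Data.Nat using (ℕ)
open import Data.Fin using (Fin; zero; suc)
open import Data.Fin.Subset using (Subset; _∈_)
open import Data.Vec using (Vec; []; _∷_)
open import Data.Bool using (true; false)
open import Data.Product using (_×_; _,_; Σ; ∃; ∃-syntax)
open import Data.Sum using (_⊎_)
open import Function using (_∘_)
open import Function.Bundles using (_⇔_)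
open import Relation.Binary.PropositionalEquality using (_≡_)
open import Relation.Binary.Structures using (IsTotalOrder)
open import Relation.Binary.Construct.Closure.ReflexiveTransitive using (Star)
open import Algebra.Bundles using (CommutativeRing)

record Graph : Set where
  field
    nV   : ℕ
    nE   : ℕ
    ends : Fin nE → Fin nV × Fin nV

open Graph public

Adj : (G : Graph) → Subset (nE G) → Fin (nV G) → Fin (nV G) → Set
Adj G E' u v = ∃[ e ] (e ∈ E' × (ends G e ≡ (u , v) ⊎ ends G e ≡ (v , u)))

Connected : (G : Graph) → Subset (nE G) → Set
Connected G E' = ∀ u v → Star (Adj G E') u v

-- Real weights: we do not have ℝ, so we work in an arbitrary totally
-- ordered commutative ring (ℝ is one); the non-separability statement
-- over every such ring in particular covers ℝ.

record OrderedCommutativeRing (c ℓ₁ ℓ₂ : Level) : Set (Level.suc (c ⊔ ℓ₁ ⊔ ℓ₂)) where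
  field
    commutativeRing : CommutativeRing c ℓ₁
  open CommutativeRing commutativeRing public
  field
    _≤_          : Carrier → Carrier → Set ℓ₂
    isTotalOrder : IsTotalOrder _≈_ _≤_
    +-monoʳ-≤    : ∀ {x y} z → x ≤ y → (x + z) ≤ (y + z)
    *-nonneg     : ∀ {x y} → 0# ≤ x → 0# ≤ y → 0# ≤ (x * y)

module _ {c ℓ₁ ℓ₂} (R : OrderedCommutativeRing c ℓ₁ ℓ₂) where
  open OrderedCommutativeRing R using (Carrier; 0#; _+_; _≤_)

  subsetSum : ∀ {m} → (Fin m → Carrier) → Subset m → Carrier
  subsetSum w []            = 0#
  subsetSum w (true  ∷ s)   = w zero + subsetSum (w ∘ suc) s
  subsetSum w (false ∷ s)   = subsetSum (w ∘ suc) s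

  Separable : Graph → Set (c ⊔ ℓ₂)
  Separable G =
    Σ (Fin (nE G) → Carrier) λ w → Σ Carrier λ α →
      (∀ e → 0# ≤ w e) ×
      (∀ (E' : Subset (nE G)) → (α ≤ subsetSum w E') ⇔ Connected G E')

-- The Glasses graph: triangles {0,1,2} and {3,4,5}, bridge 2–3.

glassesEnds : Fin 7 → Fin 6 × Fin 6
glassesEnds zero                                      = (zero , suc zero)
glassesEnds (suc zero)                                = (suc zero , suc (suc zero))
glassesEnds (suc (suc zero))                          = (suc (suc zero) , zero)
glassesEnds (suc (suc (suc zero)))                    = (suc (suc (suc zero)) , suc (suc (suc (suc zero))))
glassesEnds (suc (suc (suc (suc zero))))              = (suc (suc (suc (suc zero))) , suc (suc (suc (suc (suc zero)))))
glassesEnds (suc (suc (suc (suc (suc zero)))))        = (suc (suc (suc (suc (suc zero)))) , suc (suc (suc zero)))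
glassesEnds (suc (suc (suc (suc (suc (suc zero)))))) = (suc (suc zero) , suc (suc (suc zero)))

Glasses : Graph
Glasses = record { nV = 6 ; nE = 7 ; ends = glassesEnds }

module Submission where

open import Defs
open import Relation.Nullary using (¬_)
open import Relation.Nullary.Decidable using (True; toWitness)
open import Data.Fin using (Fin; zero; suc)
open import Data.Fin.Subset using (Subset; _∈_; _∪_; _∩_)
open import Data.Fin.Subset.Properties using (_∈?_)
open import Data.Vec using ([]; _∷_; there)
open import Data.Bool using (Bool; true; false)
open import Data.Product using (_,_; proj₁; proj₂)
open import Data.Sum using (_⊎_; inj₁; inj₂; [_,_]; map)
open import Function using (_∘_)
open import Function.Bundles using (Equivalence)
open import Relation.Binary.PropositionalEquality as ≡ using (_≡_; refl)
open import Relation.Binary.Construct.Closure.ReflexiveTransitive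
  using (Star; ε; _◅_; _◅◅_; reverse; fold)
open import Relation.Binary.Structures using (IsTotalOrder)
import Algebra.Properties.CommutativeSemigroup as CommutativeSemigroupProperties
import Relation.Binary.Reasoning.Setoid as SetoidReasoning

-- The spanning trees C₁ and C₂ (a path in each triangle plus the bridge)
-- have the same union and intersection as D₁ (first triangle, bridge and one
-- edge of the second) and D₂ (symmetrically), so w(C₁) + w(C₂) = w(D₁) + w(D₂)
-- for every weighting w. In a totally ordered group this forces
-- w(C₁) ≤ w(D₁) or w(C₂) ≤ w(D₂): one of the disconnected D₁, D₂ would reach
-- the threshold.

module _ (G : Graph) where

  Adj-sym : ∀ {E' u v} → Adj G E' u v → Adj G E' v u
  Adj-sym (e , e∈E' , inj₁ ends≡) = e , e∈E' , inj₂ ends≡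
  Adj-sym (e , e∈E' , inj₂ ends≡) = e , e∈E' , inj₁ ends≡

  reachesHub⇒connected : ∀ {E'} (h : Fin (nV G)) →
                         (∀ u → Star (Adj G E') u h) → Connected G E'
  reachesHub⇒connected h walk u v = walk u ◅◅ reverse Adj-sym (walk v)

  ConstantAlong : Subset (nE G) → (Fin (nV G) → Bool) → Set
  ConstantAlong E' p = ∀ e → e ∈ E' → p (proj₁ (ends G e)) ≡ p (proj₂ (ends G e))

  constantAlong⇒constantOnWalks : ∀ {E' p} → ConstantAlong E' p →
                                  ∀ {u v} → Star (Adj G E') u v → p u ≡ p v
  constantAlong⇒constantOnWalks {E'} {p} const = fold (λ u v → p u ≡ p v) step refl
    where
    step : ∀ {u v w} → Adj G E' u v → p v ≡ p w → p u ≡ p w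
    step (e , e∈E' , inj₁ refl) = ≡.trans (const e e∈E')
    step (e , e∈E' , inj₂ refl) = ≡.trans (≡.sym (const e e∈E'))

  constantAlong⇒¬connected : ∀ {E'} p {u v} → ConstantAlong E' p →
                             p u ≡ true → p v ≡ false → ¬ Connected G E'
  constantAlong⇒¬connected p {u} {v} const pu pv conn
    with () ← ≡.trans (≡.sym pu) (≡.trans (constantAlong⇒constantOnWalks const (conn u v)) pv)

module OrderedCommutativeRingProperties {c ℓ₁ ℓ₂} (R : OrderedCommutativeRing c ℓ₁ ℓ₂) where
  open OrderedCommutativeRing R
    using (Carrier; _≈_; _≤_; _+_; -_; 0#; setoid; isTotalOrder; +-monoʳ-≤; +-comm; +-assoc;
           +-congˡ; -‿inverseʳ; +-identityʳ; +-commutativeSemigroup)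
    renaming (refl to ≈-refl)
  open IsTotalOrder isTotalOrder using (total; ≤-respˡ-≈; ≤-respʳ-≈)
    renaming (trans to ≤-trans; reflexive to ≤-reflexive)
  open CommutativeSemigroupProperties +-commutativeSemigroup using (interchange; x∙yz≈y∙xz)
  open SetoidReasoning setoid

  +-cancelʳ-≤ : ∀ {x y} z → (x + z) ≤ (y + z) → x ≤ y
  +-cancelʳ-≤ {x} {y} z x+z≤y+z =
    ≤-respʳ-≈ (cancel y) (≤-respˡ-≈ (cancel x) (+-monoʳ-≤ (- z) x+z≤y+z))
    where
    cancel : ∀ a → (a + z) + - z ≈ a
    cancel a = begin
      (a + z) + - z  ≈⟨ +-assoc a z (- z) ⟩
      a + (z + - z)  ≈⟨ +-congˡ (-‿inverseʳ z) ⟩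
      a + 0#         ≈⟨ +-identityʳ a ⟩
      a              ∎

  +-≈-split : ∀ {x y u v} → x + y ≈ u + v → x ≤ u ⊎ y ≤ v
  +-≈-split {x} {y} {u} {v} x+y≈u+v with total x u
  ... | inj₁ x≤u = inj₁ x≤u
  ... | inj₂ u≤x = inj₂ (+-cancelʳ-≤ u
          (≤-respʳ-≈ (+-comm u v) (≤-respˡ-≈ (+-comm u y)
            (≤-trans (+-monoʳ-≤ y u≤x) (≤-reflexive x+y≈u+v)))))

  subsetSum-∪-∩ : ∀ {m} (w : Fin m → Carrier) (s t : Subset m) →
    subsetSum R w s + subsetSum R w t ≈ subsetSum R w (s ∪ t) + subsetSum R w (s ∩ t)
  subsetSum-∪-∩ w []          []          = ≈-refl
  subsetSum-∪-∩ w (true  ∷ s) (true  ∷ t) = begin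
    (w zero + S s) + (w zero + S t)                ≈⟨ interchange _ _ _ _ ⟩
    (w zero + w zero) + (S s + S t)                ≈⟨ +-congˡ (subsetSum-∪-∩ (w ∘ suc) s t) ⟩
    (w zero + w zero) + (S (s ∪ t) + S (s ∩ t))    ≈⟨ interchange _ _ _ _ ⟩
    (w zero + S (s ∪ t)) + (w zero + S (s ∩ t))    ∎
    where S = subsetSum R (w ∘ suc)
  subsetSum-∪-∩ w (true  ∷ s) (false ∷ t) = begin
    (w zero + S s) + S t                           ≈⟨ +-assoc _ _ _ ⟩
    w zero + (S s + S t)                           ≈⟨ +-congˡ (subsetSum-∪-∩ (w ∘ suc) s t) ⟩
    w zero + (S (s ∪ t) + S (s ∩ t))               ≈⟨ +-assoc _ _ _ ⟨
    (w zero + S (s ∪ t)) + S (s ∩ t)               ∎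
    where S = subsetSum R (w ∘ suc)
  subsetSum-∪-∩ w (false ∷ s) (true  ∷ t) = begin
    S s + (w zero + S t)                           ≈⟨ x∙yz≈y∙xz _ _ _ ⟩
    w zero + (S s + S t)                           ≈⟨ +-congˡ (subsetSum-∪-∩ (w ∘ suc) s t) ⟩
    w zero + (S (s ∪ t) + S (s ∩ t))               ≈⟨ +-assoc _ _ _ ⟨
    (w zero + S (s ∪ t)) + S (s ∩ t)               ∎
    where S = subsetSum R (w ∘ suc)
  subsetSum-∪-∩ w (false ∷ s) (false ∷ t) = subsetSum-∪-∩ (w ∘ suc) s t

  separable⇒exchange : ∀ {G} → Separable R G → ∀ {C₁ C₂ D₁ D₂} →
    C₁ ∪ C₂ ≡ D₁ ∪ D₂ → C₁ ∩ C₂ ≡ D₁ ∩ D₂ →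
    Connected G C₁ → Connected G C₂ → Connected G D₁ ⊎ Connected G D₂
  separable⇒exchange (w , α , _ , threshold) {C₁} {C₂} {D₁} {D₂} ∪≡ ∩≡ conn₁ conn₂ =
    map (λ C₁≤D₁ → Equivalence.to (threshold D₁) (≤-trans α≤C₁ C₁≤D₁))
        (λ C₂≤D₂ → Equivalence.to (threshold D₂) (≤-trans α≤C₂ C₂≤D₂))
        (+-≈-split (begin
          S C₁ + S C₂                    ≈⟨ subsetSum-∪-∩ w C₁ C₂ ⟩
          S (C₁ ∪ C₂) + S (C₁ ∩ C₂)      ≡⟨ ≡.cong₂ (λ s t → S s + S t) ∪≡ ∩≡ ⟩
          S (D₁ ∪ D₂) + S (D₁ ∩ D₂)      ≈⟨ subsetSum-∪-∩ w D₁ D₂ ⟨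
          S D₁ + S D₂                    ∎))
    where
    S = subsetSum R w
    α≤C₁ = Equivalence.from (threshold C₁) conn₁
    α≤C₂ = Equivalence.from (threshold C₂) conn₂

pattern v₀ = zero
pattern v₁ = suc v₀
pattern v₂ = suc v₁
pattern v₃ = suc v₂
pattern v₄ = suc v₃
pattern v₅ = suc v₄

pattern e₀₁ = zero
pattern e₁₂ = suc e₀₁
pattern e₂₀ = suc e₁₂
pattern e₃₄ = suc e₂₀
pattern e₄₅ = suc e₃₄
pattern e₅₃ = suc e₄₅
pattern e₂₃ = suc e₅₃

C₁ C₂ D₁ D₂ : Subset 7
C₁ = true ∷ true  ∷ false ∷ true ∷ true  ∷ false ∷ true ∷ []
C₂ = true ∷ false ∷ true  ∷ true ∷ false ∷ true  ∷ true ∷ []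
D₁ = true ∷ true  ∷ true  ∷ true ∷ false ∷ false ∷ true ∷ []
D₂ = true ∷ false ∷ false ∷ true ∷ true  ∷ true  ∷ true ∷ []

module _ {E' : Subset 7} where

  along against : ∀ e {_ : True (e ∈? E')} → Adj Glasses E' _ _
  along   e {e∈E'} = e , toWitness e∈E' , inj₁ refl
  against e {e∈E'} = e , toWitness e∈E' , inj₂ refl

C₁-connected : Connected Glasses C₁
C₁-connected = reachesHub⇒connected Glasses v₂ walk
  where
  walk : ∀ u → Star (Adj Glasses C₁) u v₂
  walk v₀ = along e₀₁ ◅ along e₁₂ ◅ ε
  walk v₁ = along e₁₂ ◅ ε
  walk v₂ = ε
  walk v₃ = against e₂₃ ◅ ε
  walk v₄ = against e₃₄ ◅ against e₂₃ ◅ ε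
  walk v₅ = against e₄₅ ◅ against e₃₄ ◅ against e₂₃ ◅ ε

C₂-connected : Connected Glasses C₂
C₂-connected = reachesHub⇒connected Glasses v₂ walk
  where
  walk : ∀ u → Star (Adj Glasses C₂) u v₂
  walk v₀ = against e₂₀ ◅ ε
  walk v₁ = against e₀₁ ◅ against e₂₀ ◅ ε
  walk v₂ = ε
  walk v₃ = against e₂₃ ◅ ε
  walk v₄ = against e₃₄ ◅ against e₂₃ ◅ ε
  walk v₅ = along e₅₃ ◅ against e₂₃ ◅ ε

D₁-disconnected : ¬ Connected Glasses D₁
D₁-disconnected = constantAlong⇒¬connected Glasses isolated {v₅} {v₀} const refl refl
  where
  isolated : Fin 6 → Bool
  isolated v₅ = true
  isolated _  = false

  const : ConstantAlong Glasses D₁ isolated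
  const e₀₁ _ = refl
  const e₁₂ _ = refl
  const e₂₀ _ = refl
  const e₃₄ _ = refl
  const e₄₅ (there (there (there (there ()))))
  const e₅₃ (there (there (there (there (there ())))))
  const e₂₃ _ = refl

D₂-disconnected : ¬ Connected Glasses D₂
D₂-disconnected = constantAlong⇒¬connected Glasses component {v₀} {v₂} const refl refl
  where
  component : Fin 6 → Bool
  component v₀ = true
  component v₁ = true
  component _  = false

  const : ConstantAlong Glasses D₂ component
  const e₀₁ _ = refl
  const e₁₂ (there ())
  const e₂₀ (there (there ()))
  const e₃₄ _ = refl
  const e₄₅ _ = refl
  const e₅₃ _ = refl
  const e₂₃ _ = refl

lemma6 : ∀ {c ℓ₁ ℓ₂} (R : OrderedCommutativeRing c ℓ₁ ℓ₂) → ¬ Separable R Glasses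
lemma6 R separable =
  [ D₁-disconnected , D₂-disconnected ]
    (separable⇒exchange separable {D₁ = D₁} {D₂} refl refl C₁-connected C₂-connected)
  where open OrderedCommutativeRingProperties R
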